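{- Let $T$ be a tree of order $n$ having $\varepsilon(T)$ leaves. For any positive integer $t$, the number of leaves of $S(T,t)$ is $$\varepsilon(S(T,t))=\frac{\varepsilon(T)\left(n^t-2n^{t-1}+1\right)}{n-1}.$$
   Context: A leaf of a tree is a vertex of degree one; $\varepsilon(T)$ denotes the number of leaves of a tree $T$. For a graph $G=(V,E)$ and a positive integer $t$, $V^t$ denotes the set of words $u=u_1u_2\cdots u_t$ of length $t$ over the alphabet $V$. The generalized Sierpiński graph $S(G,t)$ has vertex set $V^t$, and $\{u,v\}$ is an edge if and only if there is $i\in\{1,\dots,t\}$ such that: (i) $u_j=v_j$ for all $j<i$; (ii) $u_i\ne v_i$ and $\{u_i,v_i\}\in E$; (iii) $u_j=v_i$ and $v_j=u_i$ for all $j>i$. -}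

module Defs where

open import Data.Nat using (ℕ; zero; suc; _≤_)
open import Data.Fin using (Fin; toℕ) renaming (_<_ to _<ᶠ_; _<?_ to _<ᶠ?_)
open import Data.Fin.Properties using (any?; all?) renaming (_≟_ to _≟ᶠ_)
open import Data.Nat.Properties using (_≟_)
open import Data.List using (List; []; _∷_; _++_; [_]; length; filter; map; concatMap; allFin)
open import Data.List.Relation.Unary.Unique.Propositional using (Unique)
open import Data.List.Relation.Unary.Linked using (Linked)
open import Data.Vec using (Vec; lookup) renaming ([] to []ᵛ; _∷_ to _∷ᵛ_)
open import Data.Product using (Σ; ∃; ∃-syntax; _×_; _,_)
open import Relation.Binary using (Decidable; Symmetric)
open import Relation.Binary.PropositionalEquality using (_≡_; _≢_)
open import Relation.Nullary using (¬_; Dec)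
open import Relation.Nullary.Decidable using (_×-dec_; _→-dec_; ¬?)

record Graph (n : ℕ) : Set₁ where
  field
    E      : Fin n → Fin n → Set
    E?     : Decidable E
    E-sym  : Symmetric E
    E-irr  : ∀ x → ¬ E x x

module _ {n : ℕ} (G : Graph n) where
  open Graph G

  data Walk : Fin n → Fin n → Set where
    here : ∀ {u} → Walk u u
    step : ∀ {u w v} → E u w → Walk w v → Walk u v

  Connected : Set
  Connected = ∀ u v → Walk u v

  HasCycle : Set
  HasCycle = Σ (Fin n) λ x → Σ (List (Fin n)) λ ys →
               (2 ≤ length ys) × Unique (x ∷ ys) × Linked E (x ∷ ys ++ [ x ])

  IsTree : Set
  IsTree = Connected × ¬ HasCycle

  degree : Fin n → ℕ
  degree v = length (filter (E? v) (allFin n))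

  leaves : ℕ
  leaves = length (filter (λ v → degree v ≟ 1) (allFin n))

  words : (t : ℕ) → List (Vec (Fin n) t)
  words zero    = []ᵛ ∷ []
  words (suc t) = concatMap (λ a → map (a ∷ᵛ_) (words t)) (allFin n)

  SEdge : (t : ℕ) → Vec (Fin n) t → Vec (Fin n) t → Set
  SEdge t u v = ∃[ i ]
      ( (∀ j → j <ᶠ i → lookup u j ≡ lookup v j)
      × (lookup u i ≢ lookup v i)
      × E (lookup u i) (lookup v i)
      × (∀ j → i <ᶠ j → (lookup u j ≡ lookup v i) × (lookup v j ≡ lookup u i)) )

  SEdge? : (t : ℕ) → Decidable (SEdge t)
  SEdge? t u v = any? λ i →
      all? (λ j → (j <ᶠ? i) →-dec (lookup u j ≟ᶠ lookup v j))
      ×-dec ¬? (lookup u i ≟ᶠ lookup v i)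
      ×-dec E? (lookup u i) (lookup v i)
      ×-dec all? (λ j → (i <ᶠ? j) →-dec
                   ((lookup u j ≟ᶠ lookup v i) ×-dec (lookup v j ≟ᶠ lookup u i)))

  Sdegree : (t : ℕ) → Vec (Fin n) t → ℕ
  Sdegree t u = length (filter (SEdge? t u) (words t))

  Sleaves : ℕ → ℕ
  Sleaves t = length (filter (λ u → Sdegree t u ≟ 1) (words t))

module Submission where

-- Write N(t) for the number of leaves of S(G,t) and L for that of G. A word
-- a·u of length t+1 has degree deg(u) + #{b ~ a : u = bᵗ} in S(G,t+1): the
-- edges inside the copy a·S(G,t), plus the single cross edge a·bᵗ ~ b·aᵗ if u
-- is the extreme vertex bᵗ of a neighbour b of a. For a non-extreme u the n
-- words a·u are leaves exactly when u is; for u = cᵗ, a·u is a leaf for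
-- exactly n − 1 letters a if c is a leaf of G and for none otherwise. Summing
-- gives N(t+1) + L = n·N(t) for t ≥ 1, with N(1) = L, and this recurrence is
-- solved in closed form: (n−1)·N(t) = L·(nᵗ + 1 − 2nᵗ⁻¹). The argument works
-- for every finite simple graph.

open import Defs
open import Data.Nat using (ℕ; zero; suc; _+_; _*_; _∸_; _^_; _≤_; z≤n; s≤s)
open import Data.Nat.Properties
  using (+-*-semiring; _≟_; +-identityʳ; *-identityʳ; *-zeroʳ; *-assoc; *-comm;
         +-cancelʳ-≡; m+n∸n≡m; *-distribˡ-∸)
open import Data.Nat.ListAction using () renaming (sum to sumˡ)
open import Data.Nat.ListAction.Properties using (sum-++)
open import Data.Nat.Tactic.RingSolver using (solve-∀)
open import Data.Fin using (Fin; zero; suc) renaming (_≟_ to _≟ᶠ_)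
import Data.Fin.Properties as Fin
open import Data.List using (List; []; _∷_; _++_; map; concatMap; filter; length; tabulate; allFin)
open import Data.List.Properties using (map-++; map-tabulate; map-∘)
open import Data.Vec using (Vec; replicate; head; lookup) renaming ([] to []ᵛ; _∷_ to _∷ᵛ_)
open import Data.Vec.Properties using (≡-dec; ∷-injective; ∷-injectiveˡ; lookup-replicate)
open import Data.Bool using (true; false)
open import Data.Product using (_×_; _,_; proj₁; proj₂)
open import Data.Sum using (_⊎_; inj₁; inj₂)
open import Function using (_∘_)
open import Relation.Binary using (DecidableEquality)
open import Relation.Nullary using (¬_; Dec; yes; no; _because_; contradiction)
open import Relation.Nullary.Decidable using (_×-dec_; _⊎-dec_)
open import Relation.Binary.PropositionalEquality
  using (_≡_; _≢_; refl; sym; trans; cong; cong₂; subst; module ≡-Reasoning)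
open import Algebra.Properties.Semiring.Sum +-*-semiring
  using (sum; sum-syntax; sum-cong-≗; ∑-distrib-+; ∑-comm; *-distribˡ-sum)

⟦_⟧ : ∀ {a} {A : Set a} → Dec A → ℕ
⟦ true  because _ ⟧ = 1
⟦ false because _ ⟧ = 0

module _ {ℓ} {A : Set ℓ} where

  ⟦⟧-yes : (a? : Dec A) → A → ⟦ a? ⟧ ≡ 1
  ⟦⟧-yes (yes _) _ = refl
  ⟦⟧-yes (no ¬a) a = contradiction a ¬a

  ⟦⟧-no : (a? : Dec A) → ¬ A → ⟦ a? ⟧ ≡ 0
  ⟦⟧-no (yes a) ¬a = contradiction a ¬a
  ⟦⟧-no (no _)  _  = refl

  ⟦⟧≤1 : (a? : Dec A) → ⟦ a? ⟧ ≤ 1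
  ⟦⟧≤1 (yes _) = s≤s z≤n
  ⟦⟧≤1 (no _)  = z≤n

module _ {ℓ₁ ℓ₂} {A : Set ℓ₁} {B : Set ℓ₂} where

  ⟦⟧-cong : (A → B) → (B → A) → (a? : Dec A) (b? : Dec B) → ⟦ a? ⟧ ≡ ⟦ b? ⟧
  ⟦⟧-cong f g (yes a) b? = sym (⟦⟧-yes b? (f a))
  ⟦⟧-cong f g (no ¬a) b? = sym (⟦⟧-no b? (¬a ∘ g))

  ⟦⟧-× : (a? : Dec A) (b? : Dec B) → ⟦ a? ×-dec b? ⟧ ≡ ⟦ a? ⟧ * ⟦ b? ⟧
  ⟦⟧-× (true  because _) (true  because _) = refl
  ⟦⟧-× (true  because _) (false because _) = refl
  ⟦⟧-× (false because _) _                 = refl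

  ⟦⟧-⊎ : ¬ (A × B) → (a? : Dec A) (b? : Dec B) → ⟦ a? ⊎-dec b? ⟧ ≡ ⟦ a? ⟧ + ⟦ b? ⟧
  ⟦⟧-⊎ disjoint (yes a) (yes b) = contradiction (a , b) disjoint
  ⟦⟧-⊎ disjoint (yes _) (no _)  = refl
  ⟦⟧-⊎ disjoint (no _)  (yes _) = refl
  ⟦⟧-⊎ disjoint (no _)  (no _)  = refl

length-filter≡sum : ∀ {a p} {A : Set a} {P : A → Set p} (P? : ∀ x → Dec (P x)) (xs : List A) →
  length (filter P? xs) ≡ sumˡ (map (⟦_⟧ ∘ P?) xs)
length-filter≡sum P? []       = refl
length-filter≡sum P? (x ∷ xs) with P? x
... | yes _ = cong suc (length-filter≡sum P? xs)
... | no _  = length-filter≡sum P? xs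

sum-concatMap : ∀ {a b} {A : Set a} {B : Set b} (f : B → ℕ) (g : A → List B) (xs : List A) →
  sumˡ (map f (concatMap g xs)) ≡ sumˡ (map (λ x → sumˡ (map f (g x))) xs)
sum-concatMap f g []       = refl
sum-concatMap f g (x ∷ xs) = begin
  sumˡ (map f (g x ++ concatMap g xs))               ≡⟨ cong sumˡ (map-++ f (g x) _) ⟩
  sumˡ (map f (g x) ++ map f (concatMap g xs))        ≡⟨ sum-++ (map f (g x)) _ ⟩
  sumˡ (map f (g x)) + sumˡ (map f (concatMap g xs))  ≡⟨ cong (sumˡ (map f (g x)) +_) (sum-concatMap f g xs) ⟩
  sumˡ (map f (g x)) + sumˡ (map (λ y → sumˡ (map f (g y))) xs) ∎
  where open ≡-Reasoning

sum-allFin : ∀ {n} (f : Fin n → ℕ) → sumˡ (map f (allFin n)) ≡ ∑[ i < n ] f i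
sum-allFin {n} f = trans (cong sumˡ (map-tabulate (λ i → i) f)) (sum-tabulate f)
  where
  sum-tabulate : ∀ {k} (h : Fin k → ℕ) → sumˡ (tabulate h) ≡ sum h
  sum-tabulate {zero}  h = refl
  sum-tabulate {suc k} h = cong (h zero +_) (sum-tabulate (h ∘ suc))

∑-const : ∀ n c → ∑[ i < n ] c ≡ n * c
∑-const zero    c = refl
∑-const (suc n) c = cong (c +_) (∑-const n c)

∑-zero : ∀ n → ∑[ i < n ] 0 ≡ 0
∑-zero n = trans (∑-const n 0) (*-zeroʳ n)

∑-point : ∀ {n} (c : Fin n) (g : Fin n → ℕ) → ∑[ b < n ] (⟦ b ≟ᶠ c ⟧ * g b) ≡ g c
∑-point {suc n} zero g = begin
  g zero + 0 + ∑[ b < n ] 0 ≡⟨ cong₂ _+_ (+-identityʳ (g zero)) (∑-zero n) ⟩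
  g zero + 0                ≡⟨ +-identityʳ (g zero) ⟩
  g zero ∎
  where open ≡-Reasoning
∑-point {suc n} (suc c) g = begin
  ∑[ b < n ] (⟦ suc b ≟ᶠ suc c ⟧ * g (suc b)) ≡⟨ sum-cong-≗ (λ b → cong (_* g (suc b)) (same-bracket b)) ⟩
  ∑[ b < n ] (⟦ b ≟ᶠ c ⟧ * g (suc b))         ≡⟨ ∑-point c (g ∘ suc) ⟩
  g (suc c) ∎
  where
  open ≡-Reasoning
  same-bracket : ∀ b → ⟦ suc b ≟ᶠ suc c ⟧ ≡ ⟦ b ≟ᶠ c ⟧
  same-bracket b = ⟦⟧-cong Fin.suc-injective (cong suc) (suc b ≟ᶠ suc c) (b ≟ᶠ c)

module _ {n : ℕ} where

  Σʷ : (t : ℕ) → (Vec (Fin n) t → ℕ) → ℕ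
  Σʷ zero    f = f []ᵛ
  Σʷ (suc t) f = ∑[ a < n ] Σʷ t (λ u → f (a ∷ᵛ u))

  Σʷ-cong : ∀ t {f g : Vec (Fin n) t → ℕ} → (∀ u → f u ≡ g u) → Σʷ t f ≡ Σʷ t g
  Σʷ-cong zero    f≡g = f≡g []ᵛ
  Σʷ-cong (suc t) f≡g = sum-cong-≗ (λ a → Σʷ-cong t (λ u → f≡g (a ∷ᵛ u)))

  Σʷ-+ : ∀ t (f g : Vec (Fin n) t → ℕ) → Σʷ t (λ u → f u + g u) ≡ Σʷ t f + Σʷ t g
  Σʷ-+ zero    f g = refl
  Σʷ-+ (suc t) f g = trans (sum-cong-≗ (λ a → Σʷ-+ t (f ∘ (a ∷ᵛ_)) (g ∘ (a ∷ᵛ_))))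
                           (∑-distrib-+ (λ a → Σʷ t (f ∘ (a ∷ᵛ_))) (λ a → Σʷ t (g ∘ (a ∷ᵛ_))))

  Σʷ-scale : ∀ t (c : ℕ) (f : Vec (Fin n) t → ℕ) → Σʷ t (λ u → c * f u) ≡ c * Σʷ t f
  Σʷ-scale zero    c f = refl
  Σʷ-scale (suc t) c f = trans (sum-cong-≗ (λ a → Σʷ-scale t c (f ∘ (a ∷ᵛ_))))
                               (sym (*-distribˡ-sum c (λ a → Σʷ t (f ∘ (a ∷ᵛ_)))))

  ∑-Σʷ-comm : ∀ t (f : Fin n → Vec (Fin n) t → ℕ) →
    ∑[ a < n ] Σʷ t (f a) ≡ Σʷ t (λ u → ∑[ a < n ] f a u)
  ∑-Σʷ-comm zero    f = refl
  ∑-Σʷ-comm (suc t) f = trans (∑-comm (λ a b → Σʷ t (f a ∘ (b ∷ᵛ_))))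
                              (sum-cong-≗ (λ b → ∑-Σʷ-comm t (λ a → f a ∘ (b ∷ᵛ_))))

  _≟ʷ_ : ∀ {t} → DecidableEquality (Vec (Fin n) t)
  _≟ʷ_ = ≡-dec _≟ᶠ_

  ⟦∷≟∷⟧ : ∀ {t} (b c : Fin n) (v w : Vec (Fin n) t) →
    ⟦ (b ∷ᵛ v) ≟ʷ (c ∷ᵛ w) ⟧ ≡ ⟦ b ≟ᶠ c ⟧ * ⟦ v ≟ʷ w ⟧
  ⟦∷≟∷⟧ b c v w = trans
    (⟦⟧-cong ∷-injective (λ { (refl , refl) → refl }) ((b ∷ᵛ v) ≟ʷ (c ∷ᵛ w)) ((b ≟ᶠ c) ×-dec (v ≟ʷ w)))
    (⟦⟧-× (b ≟ᶠ c) (v ≟ʷ w))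

  Σʷ-point : ∀ t (w : Vec (Fin n) t) (g : Vec (Fin n) t → ℕ) → Σʷ t (λ v → ⟦ v ≟ʷ w ⟧ * g v) ≡ g w
  Σʷ-point zero    []ᵛ      g = +-identityʳ (g []ᵛ)
  Σʷ-point (suc t) (c ∷ᵛ w) g = begin
    ∑[ b < n ] Σʷ t (λ v → ⟦ (b ∷ᵛ v) ≟ʷ (c ∷ᵛ w) ⟧ * g (b ∷ᵛ v))
      ≡⟨ sum-cong-≗ (λ b → Σʷ-cong t (λ v → split b v)) ⟩
    ∑[ b < n ] Σʷ t (λ v → ⟦ b ≟ᶠ c ⟧ * (⟦ v ≟ʷ w ⟧ * g (b ∷ᵛ v)))
      ≡⟨ sum-cong-≗ (λ b → Σʷ-scale t ⟦ b ≟ᶠ c ⟧ _) ⟩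
    ∑[ b < n ] (⟦ b ≟ᶠ c ⟧ * Σʷ t (λ v → ⟦ v ≟ʷ w ⟧ * g (b ∷ᵛ v)))
      ≡⟨ sum-cong-≗ (λ b → cong (⟦ b ≟ᶠ c ⟧ *_) (Σʷ-point t w (g ∘ (b ∷ᵛ_)))) ⟩
    ∑[ b < n ] (⟦ b ≟ᶠ c ⟧ * g (b ∷ᵛ w))
      ≡⟨ ∑-point c (λ b → g (b ∷ᵛ w)) ⟩
    g (c ∷ᵛ w) ∎
    where
    open ≡-Reasoning
    split : ∀ b v → ⟦ (b ∷ᵛ v) ≟ʷ (c ∷ᵛ w) ⟧ * g (b ∷ᵛ v) ≡ ⟦ b ≟ᶠ c ⟧ * (⟦ v ≟ʷ w ⟧ * g (b ∷ᵛ v))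
    split b v = trans (cong (_* g (b ∷ᵛ v)) (⟦∷≟∷⟧ b c v w)) (*-assoc ⟦ b ≟ᶠ c ⟧ _ _)

  Σʷ-single : ∀ t (w : Vec (Fin n) t) → Σʷ t (λ v → ⟦ v ≟ʷ w ⟧) ≡ 1
  Σʷ-single t w = trans (Σʷ-cong t (λ v → sym (*-identityʳ ⟦ v ≟ʷ w ⟧))) (Σʷ-point t w (λ _ → 1))

  sum-words : (G : Graph n) (t : ℕ) (f : Vec (Fin n) t → ℕ) → sumˡ (map f (words G t)) ≡ Σʷ t f
  sum-words G zero    f = +-identityʳ (f []ᵛ)
  sum-words G (suc t) f = begin
    sumˡ (map f (concatMap (λ a → map (a ∷ᵛ_) (words G t)) (allFin n)))
      ≡⟨ sum-concatMap f (λ a → map (a ∷ᵛ_) (words G t)) (allFin n) ⟩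
    sumˡ (map (λ a → sumˡ (map f (map (a ∷ᵛ_) (words G t)))) (allFin n))
      ≡⟨ sum-allFin (λ a → sumˡ (map f (map (a ∷ᵛ_) (words G t)))) ⟩
    ∑[ a < n ] sumˡ (map f (map (a ∷ᵛ_) (words G t)))
      ≡⟨ sum-cong-≗ (λ a → trans (cong sumˡ (sym (map-∘ (words G t)))) (sum-words G t (f ∘ (a ∷ᵛ_)))) ⟩
    ∑[ a < n ] Σʷ t (λ u → f (a ∷ᵛ u)) ∎
    where open ≡-Reasoning

-- Counting step at an extreme vertex: if x : Fin n → {0,1} has total d, then
-- exactly (n − 1)·[d = 1] indices a satisfy d + x a = 1 (if d = 1, all but the
-- one index with x a = 1; if d = 0, none since then every x a = 0).
star-leaf-count : ∀ {n} (x : Fin n → ℕ) → (∀ a → x a ≤ 1) →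
  ∑[ a < n ] ⟦ ∑[ b < n ] x b + x a ≟ 1 ⟧ + ⟦ ∑[ b < n ] x b ≟ 1 ⟧ ≡ n * ⟦ ∑[ b < n ] x b ≟ 1 ⟧
star-leaf-count {n} x x≤1 = begin
  S + ⟦ d ≟ 1 ⟧                                    ≡⟨ cong (S +_) (sym (one-scale d)) ⟩
  S + ⟦ d ≟ 1 ⟧ * d                                ≡⟨ cong (S +_) (*-distribˡ-sum ⟦ d ≟ 1 ⟧ x) ⟩
  S + ∑[ a < n ] (⟦ d ≟ 1 ⟧ * x a)                 ≡⟨ sym (∑-distrib-+ (λ a → ⟦ d + x a ≟ 1 ⟧) (λ a → ⟦ d ≟ 1 ⟧ * x a)) ⟩
  ∑[ a < n ] (⟦ d + x a ≟ 1 ⟧ + ⟦ d ≟ 1 ⟧ * x a)   ≡⟨ sum-cong-≗ (λ a → pointwise d (x a) (x≤1 a)) ⟩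
  ∑[ a < n ] (⟦ d ≟ 1 ⟧ + ⟦ d ≟ 0 ⟧ * x a)         ≡⟨ ∑-distrib-+ (λ _ → ⟦ d ≟ 1 ⟧) (λ a → ⟦ d ≟ 0 ⟧ * x a) ⟩
  ∑[ a < n ] ⟦ d ≟ 1 ⟧ + ∑[ a < n ] (⟦ d ≟ 0 ⟧ * x a)
    ≡⟨ cong₂ _+_ (∑-const n ⟦ d ≟ 1 ⟧) (sym (*-distribˡ-sum ⟦ d ≟ 0 ⟧ x)) ⟩
  n * ⟦ d ≟ 1 ⟧ + ⟦ d ≟ 0 ⟧ * d                    ≡⟨ cong (n * ⟦ d ≟ 1 ⟧ +_) (zero-scale d) ⟩
  n * ⟦ d ≟ 1 ⟧ + 0                                ≡⟨ +-identityʳ _ ⟩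
  n * ⟦ d ≟ 1 ⟧ ∎
  where
  open ≡-Reasoning
  d = ∑[ b < n ] x b
  S = ∑[ a < n ] ⟦ d + x a ≟ 1 ⟧
  pointwise : ∀ k y → y ≤ 1 → ⟦ k + y ≟ 1 ⟧ + ⟦ k ≟ 1 ⟧ * y ≡ ⟦ k ≟ 1 ⟧ + ⟦ k ≟ 0 ⟧ * y
  pointwise 0             0 _ = refl
  pointwise 0             1 _ = refl
  pointwise 1             0 _ = refl
  pointwise 1             1 _ = refl
  pointwise (suc (suc k)) 0 _ = refl
  pointwise (suc (suc k)) 1 _ = refl
  pointwise k (suc (suc y)) (s≤s ())
  one-scale : ∀ k → ⟦ k ≟ 1 ⟧ * k ≡ ⟦ k ≟ 1 ⟧
  one-scale 0             = refl
  one-scale 1             = refl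
  one-scale (suc (suc k)) = refl
  zero-scale : ∀ k → ⟦ k ≟ 0 ⟧ * k ≡ 0
  zero-scale 0       = refl
  zero-scale (suc k) = refl

constant-word : ∀ {a} {A : Set a} {t} (w : Vec A t) (c : A) → (∀ k → lookup w k ≡ c) → w ≡ replicate t c
constant-word []ᵛ       c _    = refl
constant-word (x ∷ᵛ w) c w≡c = cong₂ _∷ᵛ_ (w≡c zero) (constant-word w c (w≡c ∘ suc))

module Sierpinski {n : ℕ} (G : Graph n) where
  open Graph G

  adj : Fin n → Fin n → ℕ
  adj a b = ⟦ E? a b ⟧

  deg : Fin n → ℕ
  deg c = ∑[ b < n ] adj c b

  degree≡deg : ∀ c → degree G c ≡ deg c
  degree≡deg c = trans (length-filter≡sum (E? c) (allFin n)) (sum-allFin (adj c))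

  deg-sym : ∀ c → ∑[ a < n ] adj a c ≡ deg c
  deg-sym c = sum-cong-≗ (λ a → ⟦⟧-cong E-sym E-sym (E? a c) (E? c a))

  Sdegree≡Σʷ : ∀ t u → Sdegree G t u ≡ Σʷ t (λ v → ⟦ SEdge? G t u v ⟧)
  Sdegree≡Σʷ t u = trans (length-filter≡sum (SEdge? G t u) (words G t)) (sum-words G t _)

  SEdge-split : ∀ {t} a (u : Vec (Fin n) t) b v → SEdge G (suc t) (a ∷ᵛ u) (b ∷ᵛ v) →
    (a ≡ b × SEdge G t u v) ⊎ (E a b × u ≡ replicate t b × v ≡ replicate t a)
  SEdge-split a u b v (zero , _ , _ , ab , tail-swap) =
    inj₂ (ab , constant-word u b (λ k → proj₁ (tail-swap (suc k) (s≤s z≤n)))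
             , constant-word v a (λ k → proj₂ (tail-swap (suc k) (s≤s z≤n))))
  SEdge-split a u b v (suc i , prefix , differ , ab , suffix) =
    inj₁ (prefix zero (s≤s z≤n) , i , (λ j → prefix (suc j) ∘ s≤s) , differ , ab , (λ j → suffix (suc j) ∘ s≤s))

  SEdge-join : ∀ {t} a (u : Vec (Fin n) t) b v →
    (a ≡ b × SEdge G t u v) ⊎ (E a b × u ≡ replicate t b × v ≡ replicate t a) → SEdge G (suc t) (a ∷ᵛ u) (b ∷ᵛ v)
  SEdge-join a u .a v (inj₁ (refl , i , prefix , differ , ab , suffix)) =
    suc i , (λ { zero _ → refl ; (suc j) (s≤s j<i) → prefix j j<i }) , differ , ab ,
      (λ { (suc j) (s≤s i<j) → suffix j i<j })
  SEdge-join a .(replicate _ b) b .(replicate _ a) (inj₂ (ab , refl , refl)) =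
    zero , (λ _ ()) , (λ a≡b → E-irr a (subst (E a) (sym a≡b) ab)) , ab ,
      (λ { (suc k) _ → lookup-replicate k b , lookup-replicate k a })

  ⟦SEdge-∷⟧ : ∀ {t} a (u : Vec (Fin n) t) b v →
    ⟦ SEdge? G (suc t) (a ∷ᵛ u) (b ∷ᵛ v) ⟧ ≡
    ⟦ a ≟ᶠ b ⟧ * ⟦ SEdge? G t u v ⟧ + adj a b * ⟦ u ≟ʷ replicate t b ⟧ * ⟦ v ≟ʷ replicate t a ⟧
  ⟦SEdge-∷⟧ {t} a u b v = begin
    ⟦ SEdge? G (suc t) (a ∷ᵛ u) (b ∷ᵛ v) ⟧
      ≡⟨ ⟦⟧-cong (SEdge-split a u b v) (SEdge-join a u b v) _ (inside ⊎-dec cross) ⟩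
    ⟦ inside ⊎-dec cross ⟧
      ≡⟨ ⟦⟧-⊎ (λ { ((refl , _) , (aa , _)) → E-irr a aa }) inside cross ⟩
    ⟦ inside ⟧ + ⟦ cross ⟧
      ≡⟨ cong₂ _+_ (⟦⟧-× (a ≟ᶠ b) (SEdge? G t u v)) cross-bracket ⟩
    ⟦ a ≟ᶠ b ⟧ * ⟦ SEdge? G t u v ⟧ + adj a b * ⟦ u ≟ʷ replicate t b ⟧ * ⟦ v ≟ʷ replicate t a ⟧ ∎
    where
    open ≡-Reasoning
    inside = (a ≟ᶠ b) ×-dec SEdge? G t u v
    cross  = E? a b ×-dec ((u ≟ʷ replicate t b) ×-dec (v ≟ʷ replicate t a))
    cross-bracket : ⟦ cross ⟧ ≡ adj a b * ⟦ u ≟ʷ replicate t b ⟧ * ⟦ v ≟ʷ replicate t a ⟧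
    cross-bracket = begin
      ⟦ cross ⟧
        ≡⟨ ⟦⟧-× (E? a b) _ ⟩
      adj a b * ⟦ (u ≟ʷ replicate t b) ×-dec (v ≟ʷ replicate t a) ⟧
        ≡⟨ cong (adj a b *_) (⟦⟧-× (u ≟ʷ replicate t b) (v ≟ʷ replicate t a)) ⟩
      adj a b * (⟦ u ≟ʷ replicate t b ⟧ * ⟦ v ≟ʷ replicate t a ⟧)
        ≡⟨ sym (*-assoc (adj a b) _ _) ⟩
      adj a b * ⟦ u ≟ʷ replicate t b ⟧ * ⟦ v ≟ʷ replicate t a ⟧ ∎

  crossDegree : ∀ {t} → Fin n → Vec (Fin n) t → ℕ
  crossDegree {t} a u = ∑[ b < n ] (adj a b * ⟦ u ≟ʷ replicate t b ⟧)

  Sdegree-∷ : ∀ t a (u : Vec (Fin n) t) → Sdegree G (suc t) (a ∷ᵛ u) ≡ Sdegree G t u + crossDegree a u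
  Sdegree-∷ t a u = begin
    Sdegree G (suc t) (a ∷ᵛ u)
      ≡⟨ Sdegree≡Σʷ (suc t) (a ∷ᵛ u) ⟩
    ∑[ b < n ] Σʷ t (λ v → ⟦ SEdge? G (suc t) (a ∷ᵛ u) (b ∷ᵛ v) ⟧)
      ≡⟨ sum-cong-≗ neighbours-in-copy ⟩
    ∑[ b < n ] (⟦ b ≟ᶠ a ⟧ * Sdegree G t u + adj a b * ⟦ u ≟ʷ replicate t b ⟧)
      ≡⟨ ∑-distrib-+ (λ b → ⟦ b ≟ᶠ a ⟧ * Sdegree G t u) (λ b → adj a b * ⟦ u ≟ʷ replicate t b ⟧) ⟩
    ∑[ b < n ] (⟦ b ≟ᶠ a ⟧ * Sdegree G t u) + crossDegree a u
      ≡⟨ cong (_+ crossDegree a u) (∑-point a (λ _ → Sdegree G t u)) ⟩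
    Sdegree G t u + crossDegree a u ∎
    where
    open ≡-Reasoning
    neighbours-in-copy : ∀ b → Σʷ t (λ v → ⟦ SEdge? G (suc t) (a ∷ᵛ u) (b ∷ᵛ v) ⟧) ≡
                               ⟦ b ≟ᶠ a ⟧ * Sdegree G t u + adj a b * ⟦ u ≟ʷ replicate t b ⟧
    neighbours-in-copy b = begin
      Σʷ t (λ v → ⟦ SEdge? G (suc t) (a ∷ᵛ u) (b ∷ᵛ v) ⟧)
        ≡⟨ Σʷ-cong t (⟦SEdge-∷⟧ a u b) ⟩
      Σʷ t (λ v → ⟦ a ≟ᶠ b ⟧ * ⟦ SEdge? G t u v ⟧ + adj a b * ⟦ u ≟ʷ replicate t b ⟧ * ⟦ v ≟ʷ replicate t a ⟧)
        ≡⟨ Σʷ-+ t _ _ ⟩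
      Σʷ t (λ v → ⟦ a ≟ᶠ b ⟧ * ⟦ SEdge? G t u v ⟧) + Σʷ t (λ v → adj a b * ⟦ u ≟ʷ replicate t b ⟧ * ⟦ v ≟ʷ replicate t a ⟧)
        ≡⟨ cong₂ _+_ (Σʷ-scale t ⟦ a ≟ᶠ b ⟧ _) (Σʷ-scale t (adj a b * ⟦ u ≟ʷ replicate t b ⟧) _) ⟩
      ⟦ a ≟ᶠ b ⟧ * Σʷ t (λ v → ⟦ SEdge? G t u v ⟧) + adj a b * ⟦ u ≟ʷ replicate t b ⟧ * Σʷ t (λ v → ⟦ v ≟ʷ replicate t a ⟧)
        ≡⟨ cong₂ _+_ (cong₂ _*_ (⟦⟧-cong sym sym (a ≟ᶠ b) (b ≟ᶠ a)) (sym (Sdegree≡Σʷ t u)))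
                     (trans (cong (adj a b * ⟦ u ≟ʷ replicate t b ⟧ *_) (Σʷ-single t (replicate t a))) (*-identityʳ _)) ⟩
      ⟦ b ≟ᶠ a ⟧ * Sdegree G t u + adj a b * ⟦ u ≟ʷ replicate t b ⟧ ∎

  crossDegree-inner : ∀ {t} a (u : Vec (Fin n) t) → (∀ b → u ≢ replicate t b) → crossDegree a u ≡ 0
  crossDegree-inner a u non-constant = trans
    (sum-cong-≗ (λ b → trans (cong (adj a b *_) (⟦⟧-no (u ≟ʷ _) (non-constant b))) (*-zeroʳ (adj a b))))
    (∑-zero n)

  ⟦extreme≟extreme⟧ : ∀ t (c b : Fin n) → ⟦ replicate (suc t) c ≟ʷ replicate (suc t) b ⟧ ≡ ⟦ b ≟ᶠ c ⟧
  ⟦extreme≟extreme⟧ t c b =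
    ⟦⟧-cong (sym ∘ ∷-injectiveˡ) (λ b≡c → cong (replicate (suc t)) (sym b≡c))
            (replicate (suc t) c ≟ʷ replicate (suc t) b) (b ≟ᶠ c)

  crossDegree-extreme : ∀ t a c → crossDegree a (replicate (suc t) c) ≡ adj a c
  crossDegree-extreme t a c = begin
    ∑[ b < n ] (adj a b * ⟦ replicate (suc t) c ≟ʷ replicate (suc t) b ⟧)
      ≡⟨ sum-cong-≗ (λ b → trans (*-comm (adj a b) ⟦ replicate (suc t) c ≟ʷ replicate (suc t) b ⟧)
                                 (cong (_* adj a b) (⟦extreme≟extreme⟧ t c b))) ⟩
    ∑[ b < n ] (⟦ b ≟ᶠ c ⟧ * adj a b)
      ≡⟨ ∑-point c (adj a) ⟩
    adj a c ∎
    where open ≡-Reasoning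

  Sdegree-extreme : ∀ t c → Sdegree G (suc t) (replicate (suc t) c) ≡ deg c
  Sdegree-extreme zero c =
    trans (Sdegree-∷ 0 c []ᵛ) (sum-cong-≗ (λ b → *-identityʳ (adj c b)))
  Sdegree-extreme (suc t) c = begin
    Sdegree G (suc (suc t)) (c ∷ᵛ replicate (suc t) c)
      ≡⟨ Sdegree-∷ (suc t) c (replicate (suc t) c) ⟩
    Sdegree G (suc t) (replicate (suc t) c) + crossDegree c (replicate (suc t) c)
      ≡⟨ cong₂ _+_ (Sdegree-extreme t c) (crossDegree-extreme t c c) ⟩
    deg c + adj c c
      ≡⟨ cong (deg c +_) (⟦⟧-no (E? c c) (E-irr c)) ⟩
    deg c + 0
      ≡⟨ +-identityʳ (deg c) ⟩
    deg c ∎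
    where open ≡-Reasoning

  isLeaf : ∀ t → Vec (Fin n) t → ℕ
  isLeaf t u = ⟦ Sdegree G t u ≟ 1 ⟧

  Sleaves≡Σʷ : ∀ t → Sleaves G t ≡ Σʷ t (isLeaf t)
  Sleaves≡Σʷ t = trans (length-filter≡sum (λ u → Sdegree G t u ≟ 1) (words G t)) (sum-words G t (isLeaf t))

  leaves≡∑ : leaves G ≡ ∑[ c < n ] ⟦ deg c ≟ 1 ⟧
  leaves≡∑ = begin
    leaves G                                         ≡⟨ length-filter≡sum (λ c → degree G c ≟ 1) (allFin n) ⟩
    sumˡ (map (λ c → ⟦ degree G c ≟ 1 ⟧) (allFin n)) ≡⟨ sum-allFin (λ c → ⟦ degree G c ≟ 1 ⟧) ⟩
    ∑[ c < n ] ⟦ degree G c ≟ 1 ⟧                    ≡⟨ sum-cong-≗ (λ c → cong (λ d → ⟦ d ≟ 1 ⟧) (degree≡deg c)) ⟩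
    ∑[ c < n ] ⟦ deg c ≟ 1 ⟧ ∎
    where open ≡-Reasoning

  -- S(G,1) is a copy of G.
  Sleaves-one : Sleaves G 1 ≡ leaves G
  Sleaves-one = begin
    Sleaves G 1                             ≡⟨ Sleaves≡Σʷ 1 ⟩
    ∑[ c < n ] isLeaf 1 (replicate 1 c)     ≡⟨ sum-cong-≗ (λ c → cong (λ d → ⟦ d ≟ 1 ⟧) (Sdegree-extreme 0 c)) ⟩
    ∑[ c < n ] ⟦ deg c ≟ 1 ⟧                ≡⟨ sym leaves≡∑ ⟩
    leaves G ∎
    where open ≡-Reasoning

  isExtreme : ∀ {t} → Vec (Fin n) t → ℕ
  isExtreme {t} u = ∑[ c < n ] ⟦ u ≟ʷ replicate t c ⟧

  leaves≡extreme-leaves : ∀ t → leaves G ≡ Σʷ (suc t) (λ u → isLeaf (suc t) u * isExtreme u)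
  leaves≡extreme-leaves t = begin
    leaves G
      ≡⟨ leaves≡∑ ⟩
    ∑[ c < n ] ⟦ deg c ≟ 1 ⟧
      ≡⟨ sum-cong-≗ (λ c → cong (λ d → ⟦ d ≟ 1 ⟧) (sym (Sdegree-extreme t c))) ⟩
    ∑[ c < n ] isLeaf (suc t) (replicate (suc t) c)
      ≡⟨ sum-cong-≗ (λ c → sym (Σʷ-point (suc t) (replicate (suc t) c) (isLeaf (suc t)))) ⟩
    ∑[ c < n ] Σʷ (suc t) (λ u → ⟦ u ≟ʷ replicate (suc t) c ⟧ * isLeaf (suc t) u)
      ≡⟨ ∑-Σʷ-comm (suc t) (λ c u → ⟦ u ≟ʷ replicate (suc t) c ⟧ * isLeaf (suc t) u) ⟩
    Σʷ (suc t) (λ u → ∑[ c < n ] (⟦ u ≟ʷ replicate (suc t) c ⟧ * isLeaf (suc t) u))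
      ≡⟨ Σʷ-cong (suc t) factor ⟩
    Σʷ (suc t) (λ u → isLeaf (suc t) u * isExtreme u) ∎
    where
    open ≡-Reasoning
    factor : ∀ u → ∑[ c < n ] (⟦ u ≟ʷ replicate (suc t) c ⟧ * isLeaf (suc t) u) ≡ isLeaf (suc t) u * isExtreme u
    factor u = trans (sum-cong-≗ (λ c → *-comm ⟦ u ≟ʷ replicate (suc t) c ⟧ (isLeaf (suc t) u)))
                     (sym (*-distribˡ-sum (isLeaf (suc t) u) (λ c → ⟦ u ≟ʷ replicate (suc t) c ⟧)))

  LeafFibre : ∀ t → Vec (Fin n) (suc t) → Set
  LeafFibre t u = ∑[ a < n ] isLeaf (suc (suc t)) (a ∷ᵛ u) + isLeaf (suc t) u * isExtreme u ≡ n * isLeaf (suc t) u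

  leaf-fibre-inner : ∀ t (u : Vec (Fin n) (suc t)) → (∀ b → u ≢ replicate (suc t) b) → LeafFibre t u
  leaf-fibre-inner t u non-constant = begin
    ∑[ a < n ] isLeaf (suc (suc t)) (a ∷ᵛ u) + isLeaf (suc t) u * isExtreme u
      ≡⟨ cong₂ _+_ (sum-cong-≗ same-leaf) (cong (isLeaf (suc t) u *_) not-extreme) ⟩
    ∑[ a < n ] isLeaf (suc t) u + isLeaf (suc t) u * 0
      ≡⟨ cong₂ _+_ (∑-const n (isLeaf (suc t) u)) (*-zeroʳ (isLeaf (suc t) u)) ⟩
    n * isLeaf (suc t) u + 0
      ≡⟨ +-identityʳ _ ⟩
    n * isLeaf (suc t) u ∎
    where
    open ≡-Reasoning
    same-leaf : ∀ a → isLeaf (suc (suc t)) (a ∷ᵛ u) ≡ isLeaf (suc t) u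
    same-leaf a = cong (λ d → ⟦ d ≟ 1 ⟧)
      (trans (Sdegree-∷ (suc t) a u) (trans (cong (Sdegree G (suc t) u +_) (crossDegree-inner a u non-constant))
                                            (+-identityʳ _)))
    not-extreme : isExtreme u ≡ 0
    not-extreme = trans (sum-cong-≗ (λ c → ⟦⟧-no (u ≟ʷ _) (non-constant c))) (∑-zero n)

  -- For u = cᵗ⁺¹, a·u has degree deg c + [a ~ c]; count with star-leaf-count.
  leaf-fibre-extreme : ∀ t c → LeafFibre t (replicate (suc t) c)
  leaf-fibre-extreme t c = begin
    ∑[ a < n ] isLeaf (suc (suc t)) (a ∷ᵛ e) + isLeaf (suc t) e * isExtreme e
      ≡⟨ cong₂ _+_ (sum-cong-≗ leaf-degree) (cong₂ _*_ (cong (λ d → ⟦ d ≟ 1 ⟧) (Sdegree-extreme t c)) extreme) ⟩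
    ∑[ a < n ] ⟦ deg c + adj a c ≟ 1 ⟧ + ⟦ deg c ≟ 1 ⟧ * 1
      ≡⟨ cong (∑[ a < n ] ⟦ deg c + adj a c ≟ 1 ⟧ +_) (*-identityʳ _) ⟩
    ∑[ a < n ] ⟦ deg c + adj a c ≟ 1 ⟧ + ⟦ deg c ≟ 1 ⟧
      ≡⟨ subst (λ d → ∑[ a < n ] ⟦ d + adj a c ≟ 1 ⟧ + ⟦ d ≟ 1 ⟧ ≡ n * ⟦ d ≟ 1 ⟧) (deg-sym c)
               (star-leaf-count (λ a → adj a c) (λ a → ⟦⟧≤1 (E? a c))) ⟩
    n * ⟦ deg c ≟ 1 ⟧
      ≡⟨ cong (λ d → n * ⟦ d ≟ 1 ⟧) (sym (Sdegree-extreme t c)) ⟩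
    n * isLeaf (suc t) e ∎
    where
    open ≡-Reasoning
    e = replicate (suc t) c
    leaf-degree : ∀ a → isLeaf (suc (suc t)) (a ∷ᵛ e) ≡ ⟦ deg c + adj a c ≟ 1 ⟧
    leaf-degree a = cong (λ d → ⟦ d ≟ 1 ⟧)
      (trans (Sdegree-∷ (suc t) a e) (cong₂ _+_ (Sdegree-extreme t c) (crossDegree-extreme t a c)))
    extreme : isExtreme e ≡ 1
    extreme = trans (sum-cong-≗ (λ b → trans (⟦extreme≟extreme⟧ t c b) (sym (*-identityʳ ⟦ b ≟ᶠ c ⟧))))
                    (∑-point c (λ _ → 1))

  leaf-fibre : ∀ t (u : Vec (Fin n) (suc t)) → LeafFibre t u
  leaf-fibre t u with u ≟ʷ replicate (suc t) (head u)
  ... | yes u≡cᵗ = subst (LeafFibre t) (sym u≡cᵗ) (leaf-fibre-extreme t (head u))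
  ... | no  u≢cᵗ = leaf-fibre-inner t u (λ b u≡bᵗ → u≢cᵗ (trans u≡bᵗ (cong (replicate (suc t)) (sym (cong head u≡bᵗ)))))

  leaf-recurrence : ∀ t → Sleaves G (suc (suc t)) + leaves G ≡ n * Sleaves G (suc t)
  leaf-recurrence t = begin
    Sleaves G (suc (suc t)) + leaves G
      ≡⟨ cong₂ _+_ (trans (Sleaves≡Σʷ (suc (suc t))) (∑-Σʷ-comm (suc t) (λ a u → isLeaf (suc (suc t)) (a ∷ᵛ u))))
                   (leaves≡extreme-leaves t) ⟩
    Σʷ (suc t) (λ u → ∑[ a < n ] isLeaf (suc (suc t)) (a ∷ᵛ u)) + Σʷ (suc t) (λ u → isLeaf (suc t) u * isExtreme u)
      ≡⟨ sym (Σʷ-+ (suc t) (λ u → ∑[ a < n ] isLeaf (suc (suc t)) (a ∷ᵛ u)) (λ u → isLeaf (suc t) u * isExtreme u)) ⟩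
    Σʷ (suc t) (λ u → ∑[ a < n ] isLeaf (suc (suc t)) (a ∷ᵛ u) + isLeaf (suc t) u * isExtreme u)
      ≡⟨ Σʷ-cong (suc t) (leaf-fibre t) ⟩
    Σʷ (suc t) (λ u → n * isLeaf (suc t) u)
      ≡⟨ Σʷ-scale (suc t) n (isLeaf (suc t)) ⟩
    n * Σʷ (suc t) (isLeaf (suc t))
      ≡⟨ cong (n *_) (sym (Sleaves≡Σʷ (suc t))) ⟩
    n * Sleaves G (suc t) ∎
    where open ≡-Reasoning

recurrence-solution : ∀ m L (N : ℕ → ℕ) → N 0 ≡ L → (∀ t → N (suc t) + L ≡ suc m * N t) →
  ∀ t → m * N t + 2 * L * suc m ^ t ≡ L * (suc m ^ suc t + 1)
recurrence-solution m L N N₀≡L recurrence zero =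
  trans (cong (λ x → m * x + 2 * L * 1) N₀≡L) (base m L)
  where
  base : ∀ m L → m * L + 2 * L * 1 ≡ L * (suc m * 1 + 1)
  base = solve-∀
recurrence-solution m L N N₀≡L recurrence (suc t) = +-cancelʳ-≡ (m * L) _ _ (begin
  m * N (suc t) + 2 * L * (suc m * P) + m * L  ≡⟨ regroup m (N (suc t)) L P ⟩
  m * (N (suc t) + L) + 2 * L * (suc m * P)    ≡⟨ cong (λ x → m * x + 2 * L * (suc m * P)) (recurrence t) ⟩
  m * (suc m * N t) + 2 * L * (suc m * P)      ≡⟨ factor m (N t) L P ⟩
  suc m * (m * N t + 2 * L * P)                ≡⟨ cong (suc m *_) (recurrence-solution m L N N₀≡L recurrence t) ⟩
  suc m * (L * (suc m * P + 1))                ≡⟨ expand m L P ⟩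
  L * (suc m * (suc m * P) + 1) + m * L        ∎)
  where
  open ≡-Reasoning
  P = suc m ^ t
  regroup : ∀ m x L P → m * x + 2 * L * (suc m * P) + m * L ≡ m * (x + L) + 2 * L * (suc m * P)
  regroup = solve-∀
  factor : ∀ m x L P → m * (suc m * x) + 2 * L * (suc m * P) ≡ suc m * (m * x + 2 * L * P)
  factor = solve-∀
  expand : ∀ m L P → suc m * (L * (suc m * P + 1)) ≡ L * (suc m * (suc m * P) + 1) + m * L
  expand = solve-∀

theorem4 : (n : ℕ) (T : Graph n) → IsTree T → (t : ℕ) → 1 ≤ t →
    (n ∸ 1) * Sleaves T t ≡ leaves T * (n ^ t + 1 ∸ 2 * n ^ (t ∸ 1))
theorem4 zero    T _ (suc t) _ = refl
theorem4 (suc m) T _ (suc t) _ = begin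
  m * N t                                     ≡⟨ m+n∸n≡m (m * N t) (2 * L * P) ⟨
  m * N t + 2 * L * P ∸ 2 * L * P             ≡⟨ cong₂ _∸_ closed-form (trans (cong (_* P) (*-comm 2 L)) (*-assoc L 2 P)) ⟩
  L * (suc m ^ suc t + 1) ∸ L * (2 * P)       ≡⟨ *-distribˡ-∸ L (suc m ^ suc t + 1) (2 * P) ⟨
  L * (suc m ^ suc t + 1 ∸ 2 * P)             ∎
  where
  open ≡-Reasoning
  open Sierpinski T
  L = leaves T
  P = suc m ^ t
  N : ℕ → ℕ
  N t = Sleaves T (suc t)
  closed-form : m * N t + 2 * L * P ≡ L * (suc m ^ suc t + 1)
  closed-form = recurrence-solution m L N Sleaves-one leaf-recurrence t
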